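{- Let $q$ be a prime power and $m\ge2$ an even integer. Then $\Gamma_{q,m}(\frac m2)=q^{m/2}K_{q^{m/2}}$ (the disjoint union of $q^{m/2}$ copies of the complete graph on $q^{m/2}$ vertices), and its complement is $\bar\Gamma_{q,m}(\frac m2)=K_{q^{m/2}\times q^{m/2}}$ (the complete $q^{m/2}$-partite graph with all parts of size $q^{m/2}$).
   Context: $S_{q,m}(\ell)=\{x^{q^\ell+1}:x\in\mathbb F_{q^m}^*\}$ and $\Gamma_{q,m}(\ell)$ is the Cayley graph with vertex set $\mathbb F_{q^m}$ and $x\sim y$ iff $y-x\in S_{q,m}(\ell)$; $\bar\Gamma$ denotes the complement graph. Equalities of graphs are up to isomorphism. -}

module Defs where

open import Level using (0ℓ)
open import Data.Nat as ℕ using (ℕ; zero; suc; _≥_)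
open import Data.Nat.Primality using (Prime)
open import Data.Fin using (Fin)
open import Data.Product using (Σ; ∃; ∃-syntax; _×_; _,_)
open import Relation.Binary.PropositionalEquality using (_≡_; _≢_)
open import Relation.Nullary using (¬_)
open import Algebra.Structures using (IsCommutativeRing)
open import Function.Bundles using (_↔_; _⇔_; Inverse)

IsPrimePower : ℕ → Set
IsPrimePower q = ∃[ p ] ∃[ k ] (Prime p × k ≥ 1 × q ≡ p ℕ.^ k)

record FiniteField (n : ℕ) : Set₁ where
  field
    Carrier : Set
    _+_ _*_ : Carrier → Carrier → Carrier
    -_      : Carrier → Carrier
    0# 1#   : Carrier
    isCommutativeRing : IsCommutativeRing _≡_ _+_ _*_ -_ 0# 1#
    0≢1     : 0# ≢ 1#
    inverse : ∀ x → x ≢ 0# → ∃[ y ] (x * y ≡ 1#)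
    enumeration : Carrier ↔ Fin n

  infixl 6 _-_
  _-_ : Carrier → Carrier → Carrier
  x - y = x + (- y)

  _^_ : Carrier → ℕ → Carrier
  x ^ zero  = 1#
  x ^ suc k = x * (x ^ k)

record Graph : Set₁ where
  field
    V   : Set
    Adj : V → V → Set

open Graph public

_≅_ : Graph → Graph → Set
G ≅ H = Σ (V G ↔ V H) λ f →
  ∀ x y → Adj G x y ⇔ Adj H (Inverse.to f x) (Inverse.to f y)

complement : Graph → Graph
complement G = record { V = V G ; Adj = λ x y → x ≢ y × ¬ Adj G x y }

module _ {q m : ℕ} (F : FiniteField (q ℕ.^ m)) where
  open FiniteField F

  InS : ℕ → Carrier → Set
  InS ℓ s = ∃[ x ] (x ≢ 0# × s ≡ x ^ (q ℕ.^ ℓ ℕ.+ 1))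

  Γ : ℕ → Graph
  Γ ℓ = record { V = Carrier ; Adj = λ x y → InS ℓ (y - x) }

-- n K_n : disjoint union of n copies of K_n; vertices (copy, index)
copiesOfComplete : ℕ → ℕ → Graph
copiesOfComplete c n = record
  { V = Fin c × Fin n
  ; Adj = λ { (i , j) (i' , j') → i ≡ i' × j ≢ j' } }

-- complete c-partite graph with all parts of size n; vertices (part, index)
completeMultipartite : ℕ → ℕ → Graph
completeMultipartite c n = record
  { V = Fin c × Fin n
  ; Adj = λ { (i , j) (i' , j') → i ≢ i' } }

module Submission where

-- Write Q = q^k, so that |F| = Q².  Frobenius and Fermat make conj x = x^Q an
-- automorphism of order two; its fixed field K has at most Q elements (roots
-- of X^Q - X), and any ω ∉ K gives F = K ⊕ K ω, so |K| = Q.  The norm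
-- z^(Q+1) = z · conj z lies in K, and since each fibre has at most Q + 1
-- points, counting shows that it maps F* onto K*.  So S = K*, and x ∼ y iff x,
-- y are distinct elements of one coset of K: with the ω-coordinate indexing the
-- coset, Γ is Q copies of K_Q, and its complement is complete Q-partite.

open import Level using (0ℓ)
open import Data.Nat as ℕ using (ℕ; zero; suc; _≤_; _<_; _≥_; z≤n; s≤s)
import Data.Nat.Properties as ℕ
open import Data.Nat.Combinatorics using (_C_; nCk+nC[k+1]≡[n+1]C[k+1]; nC1≡n; nCn≡1)
open import Data.Nat.Divisibility using (_∣_; divides; ∣⇒≤)
open import Data.Nat.Primality using (Prime; euclidsLemma; prime⇒nonTrivial)
open import Data.Nat.Solver using (module +-*-Solver)
open import Data.Integer as ℤ using (ℤ; -[1+_]; _⊖_)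
import Data.Integer.Properties as ℤ
open import Data.Sign as Sign using (Sign)
open import Data.Sum using (inj₁; inj₂)
import Data.Maybe as Maybe
open import Data.Fin as Fin using (Fin; toℕ; fromℕ)
import Data.Fin.Properties as Fin
open import Data.Fin.Permutation using (Permutation; ↔⇒≡)
open import Data.Vec.Functional as Vector using (Vector; removeAt)
open import Data.List using (List; []; _∷_; length; filter; lookup; tabulate; replicate)
open import Data.List.Properties using (length-tabulate; length-replicate; filter-all; filter-notAll)
open import Data.List.Relation.Unary.All as All using (All; []; _∷_)
import Data.List.Relation.Unary.All.Properties as Allₚ
open import Data.List.Relation.Unary.Any as Any using (here; there)
import Data.List.Relation.Unary.Any.Properties as Anyₚ
open import Data.List.Relation.Unary.AllPairs using (_∷_)
open import Data.List.Relation.Unary.Unique.Propositional using (Unique)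
import Data.List.Relation.Unary.Unique.Propositional.Properties as Uniqueₚ
open import Data.List.Membership.Propositional using (_∈_; lose)
import Data.List.Membership.Propositional.Properties as ∈ₚ
open import Data.List.Membership.Setoid.Properties using (index-injective)
open import Data.Product using (∃; _×_; _,_; proj₁; proj₂; uncurry)
open import Function.Base using (_∘_; case_of_)
open import Function.Bundles using (_↔_; Inverse; Equivalence; mk↔ₛ′; mk⇔)
open import Function.Properties.Inverse using (↔-sym; ↔-trans)
open import Relation.Nullary using (¬_; Dec; yes; no; ¬?; contradiction)
import Relation.Nullary.Decidable as Dec
open import Relation.Unary using (Decidable)
open import Relation.Unary.Properties using (∁?)
open import Relation.Binary.Definitions using (DecidableEquality; tri<; tri≈; tri>)
open import Relation.Binary.PropositionalEquality
  using (_≡_; _≢_; refl; sym; trans; cong; cong₂; subst; module ≡-Reasoning)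
import Relation.Binary.PropositionalEquality as ≡
open import Relation.Binary.Consequences using (dec⇒weaklyDec)
open import Algebra.Core using (Op₁; Op₂)
open import Algebra.Bundles using (CommutativeMonoid; CommutativeRing; RawRing)
open import Algebra.Structures using (IsCommutativeRing)
import Algebra.Solver.Ring
import Algebra.Solver.Ring.AlmostCommutativeRing as ACR
open import Defs

[1+k]*[1+n]C[1+k]≡[1+n]*nCk : ∀ n k → suc k ℕ.* (suc n C suc k) ≡ suc n ℕ.* (n C k)
[1+k]*[1+n]C[1+k]≡[1+n]*nCk zero    zero    = refl
[1+k]*[1+n]C[1+k]≡[1+n]*nCk zero    (suc k) = ℕ.*-zeroʳ (suc (suc k))
[1+k]*[1+n]C[1+k]≡[1+n]*nCk (suc n) zero    = begin
  1 ℕ.* (suc (suc n) C 1) ≡⟨ ℕ.*-identityˡ _ ⟩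
  suc (suc n) C 1         ≡⟨ nC1≡n (suc (suc n)) ⟩
  suc (suc n)             ≡⟨ ℕ.*-identityʳ _ ⟨
  suc (suc n) ℕ.* 1       ∎
  where open ≡-Reasoning
[1+k]*[1+n]C[1+k]≡[1+n]*nCk (suc n) (suc k) = begin
  suc (suc k) ℕ.* (suc (suc n) C suc (suc k))
    ≡⟨ cong (suc (suc k) ℕ.*_) (nCk+nC[k+1]≡[n+1]C[k+1] (suc n) (suc k)) ⟨
  suc (suc k) ℕ.* (A ℕ.+ B)
    ≡⟨ solve 3 (λ k A B → (con 2 :+ k) :* (A :+ B) := ((con 1 :+ k) :* A :+ A) :+ (con 2 :+ k) :* B) refl k A B ⟩
  (suc k ℕ.* A ℕ.+ A) ℕ.+ suc (suc k) ℕ.* B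
    ≡⟨ cong₂ (λ u v → (u ℕ.+ A) ℕ.+ v) ([1+k]*[1+n]C[1+k]≡[1+n]*nCk n k) ([1+k]*[1+n]C[1+k]≡[1+n]*nCk n (suc k)) ⟩
  (suc n ℕ.* x ℕ.+ A) ℕ.+ suc n ℕ.* y
    ≡⟨ solve 4 (λ n x y A → ((con 1 :+ n) :* x :+ A) :+ (con 1 :+ n) :* y := (con 1 :+ n) :* (x :+ y) :+ A) refl n x y A ⟩
  suc n ℕ.* (x ℕ.+ y) ℕ.+ A
    ≡⟨ cong (λ u → suc n ℕ.* u ℕ.+ A) (nCk+nC[k+1]≡[n+1]C[k+1] n k) ⟩
  suc n ℕ.* A ℕ.+ A
    ≡⟨ solve 2 (λ n A → (con 1 :+ n) :* A :+ A := (con 2 :+ n) :* A) refl n A ⟩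
  suc (suc n) ℕ.* A ∎
  where
  open ≡-Reasoning
  open +-*-Solver
  A B x y : ℕ
  A = suc n C suc k
  B = suc n C suc (suc k)
  x = n C k
  y = n C suc k

prime∣pCk : ∀ {p k} → Prime p → 0 < k → k < p → p ∣ p C k
prime∣pCk {suc n} {suc k} p-prime _ k<p
  with euclidsLemma (suc k) (suc n C suc k) p-prime
         (divides (n C k) (trans ([1+k]*[1+n]C[1+k]≡[1+n]*nCk n k) (ℕ.*-comm (suc n) (n C k))))
... | inj₁ p∣k = contradiction (∣⇒≤ p∣k) (ℕ.<⇒≱ k<p)
... | inj₂ p∣C = p∣C

m*m≡n*n⇒m≡n : ∀ {m n} → m ℕ.* m ≡ n ℕ.* n → m ≡ n
m*m≡n*n⇒m≡n {m} {n} eq with ℕ.<-cmp m n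
... | tri< m<n _ _ = contradiction eq (ℕ.<⇒≢ (ℕ.*-mono-< m<n m<n))
... | tri≈ _ m≡n _ = m≡n
... | tri> _ _ n<m = contradiction (sym eq) (ℕ.<⇒≢ (ℕ.*-mono-< n<m n<m))

m<n⇒m*[1+n]<n*n : ∀ {m n} → m < n → m ℕ.* suc n < n ℕ.* n
m<n⇒m*[1+n]<n*n {m} {n} m<n = begin-strict
  m ℕ.* suc n      ≡⟨ ℕ.*-suc m n ⟩
  m ℕ.+ m ℕ.* n    <⟨ ℕ.+-monoˡ-< (m ℕ.* n) m<n ⟩
  n ℕ.+ m ℕ.* n    ≤⟨ ℕ.*-monoˡ-≤ n m<n ⟩
  n ℕ.* n          ∎
  where open ℕ.≤-Reasoning

2≤m⇒1≤n⇒2≤m^n : ∀ {m n} → 2 ≤ m → 1 ≤ n → 2 ≤ m ℕ.^ n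
2≤m⇒1≤n⇒2≤m^n {m} {suc n} 2≤m _ = ℕ.*-mono-≤ 2≤m (ℕ.m^n>0 m {{ℕ.>-nonZero (ℕ.≤-trans (s≤s z≤n) 2≤m)}} n)

Unique⇒lookup-injective : ∀ {A : Set} {xs : List A} → Unique xs →
                          ∀ i j → lookup xs i ≡ lookup xs j → i ≡ j
Unique⇒lookup-injective {xs = x ∷ xs} _           Fin.zero    Fin.zero    _  = refl
Unique⇒lookup-injective {xs = x ∷ xs} (x∉ ∷ _)    Fin.zero    (Fin.suc j) eq = contradiction eq (All.lookup x∉ (∈ₚ.∈-lookup j))
Unique⇒lookup-injective {xs = x ∷ xs} (x∉ ∷ _)    (Fin.suc i) Fin.zero    eq = contradiction (sym eq) (All.lookup x∉ (∈ₚ.∈-lookup i))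
Unique⇒lookup-injective {xs = x ∷ xs} (_  ∷ xs!)  (Fin.suc i) (Fin.suc j) eq = cong Fin.suc (Unique⇒lookup-injective xs! i j eq)

length-filter+length-filter-∁ : ∀ {A : Set} {P : A → Set} (P? : Decidable P) xs →
                                length (filter P? xs) ℕ.+ length (filter (∁? P?) xs) ≡ length xs
length-filter+length-filter-∁ P? []       = refl
length-filter+length-filter-∁ P? (x ∷ xs) with P? x
... | yes _ = cong suc (length-filter+length-filter-∁ P? xs)
... | no  _ = trans (ℕ.+-suc _ _) (cong suc (length-filter+length-filter-∁ P? xs))

module _ {A B : Set} (_≟_ : DecidableEquality B) (f : A → B) (b : ℕ)
  (fibre-bound : ∀ y zs → Unique zs → All (λ z → f z ≡ y) zs → length zs ≤ b) where

  length≤length*fibreBound : ∀ ys xs → Unique xs → All (λ x → f x ∈ ys) xs →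
                             length xs ≤ length ys ℕ.* b
  length≤length*fibreBound []       []       _   _         = z≤n
  length≤length*fibreBound []       (x ∷ _)  _   (() All.∷ _)
  length≤length*fibreBound (y ∷ ys) xs       xs! f[xs]⊆ys = begin
    length xs                                         ≡⟨ length-filter+length-filter-∁ over-y? xs ⟨
    length (filter over-y? xs) ℕ.+ length (filter (∁? over-y?) xs)
      ≤⟨ ℕ.+-mono-≤ (fibre-bound y _ (Uniqueₚ.filter⁺ over-y? xs!) (Allₚ.all-filter over-y? xs))
                     (length≤length*fibreBound ys _ (Uniqueₚ.filter⁺ (∁? over-y?) xs!) rest⊆ys) ⟩
    b ℕ.+ length ys ℕ.* b                             ∎
    where
    open ℕ.≤-Reasoning
    over-y? : Decidable (λ x → f x ≡ y)
    over-y? x = f x ≟ y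
    rest⊆ys : All (λ x → f x ∈ ys) (filter (∁? over-y?) xs)
    rest⊆ys = All.tabulate λ x∈ → case ∈ₚ.∈-filter⁻ (∁? over-y?) x∈ of λ where
      (x∈xs , fx≢y) → case All.lookup f[xs]⊆ys x∈xs of λ where
        (here fx≡y) → contradiction fx≡y fx≢y
        (there fx∈ys) → fx∈ys

module _ (M : CommutativeMonoid 0ℓ 0ℓ) where
  open CommutativeMonoid M using (Carrier; _≈_; monoid; setoid) renaming (_∙_ to _+_; ε to 0#; ∙-congˡ to +-congˡ; identityʳ to +-identityʳ)
  open import Algebra.Properties.Monoid.Sum monoid using (sum; sum-cong-≋; sum-replicate-zero)
  open import Algebra.Properties.CommutativeMonoid.Sum M using (sum-remove)
  open import Relation.Binary.Reasoning.Setoid setoid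

  sum-single : ∀ {n} (t : Vector Carrier n) i → (∀ j → j ≢ i → t j ≈ 0#) → sum t ≈ t i
  sum-single {suc n} t i vanish = begin
    sum t                              ≈⟨ sum-remove t ⟩
    t i + sum (removeAt t i)           ≈⟨ +-congˡ (sum-cong-≋ λ j → vanish _ (Fin.punchInᵢ≢i i j)) ⟩
    t i + sum (Vector.replicate n 0#)  ≈⟨ +-congˡ (sum-replicate-zero n) ⟩
    t i + 0#                           ≈⟨ +-identityʳ _ ⟩
    t i                                ∎

module FiniteSum {T : Set} {n : ℕ} (enumeration : T ↔ Fin n) (M : CommutativeMonoid 0ℓ 0ℓ) where
  open CommutativeMonoid M using (Carrier; _≈_; monoid; setoid) renaming (_∙_ to _+_; ε to 0#)
  open import Algebra.Properties.Monoid.Sum monoid using (sum; sum-cong-≗; sum-replicate)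
  open import Algebra.Properties.Monoid.Mult monoid using () renaming (_×_ to _×ᴺ_)
  open import Algebra.Properties.CommutativeMonoid.Sum M using (sum-permute; ∑-distrib-+)
  open import Relation.Binary.Reasoning.Setoid setoid
  private module E = Inverse enumeration

  ∑ : (T → Carrier) → Carrier
  ∑ h = sum (h ∘ E.from)

  ∑-reindex : (π : T ↔ T) (h : T → Carrier) → ∑ h ≈ ∑ (h ∘ Inverse.to π)
  ∑-reindex π h = begin
    sum (h ∘ E.from)                        ≈⟨ sum-permute (h ∘ E.from) σ ⟩
    sum (h ∘ E.from ∘ E.to ∘ π.to ∘ E.from) ≡⟨ sum-cong-≗ {n} (λ i → cong h (E.strictlyInverseʳ (π.to (E.from i)))) ⟩
    sum (h ∘ π.to ∘ E.from)                 ∎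
    where
    module π = Inverse π
    σ : Permutation n n
    σ = ↔-trans (↔-sym enumeration) (↔-trans π enumeration)

  ∑-const : ∀ c → ∑ (λ _ → c) ≈ n ×ᴺ c
  ∑-const c = sum-replicate n

  ∑-distrib : ∀ f g → ∑ (λ x → f x + g x) ≈ ∑ f + ∑ g
  ∑-distrib f g = ∑-distrib-+ (f ∘ E.from) (g ∘ E.from)

  ∑-single : ∀ (h : T → Carrier) a → (∀ x → x ≢ a → h x ≈ 0#) → ∑ h ≈ h a
  ∑-single h a vanish = begin
    sum (h ∘ E.from)      ≈⟨ sum-single M (h ∘ E.from) (E.to a) (λ j j≢a → vanish (E.from j) (λ eq → j≢a (trans (sym (E.strictlyInverseˡ j)) (cong E.to eq)))) ⟩
    h (E.from (E.to a))   ≡⟨ cong h (E.strictlyInverseʳ a) ⟩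
    h a                   ∎

  ∑-cong : ∀ {f g : T → Carrier} → (∀ x → f x ≡ g x) → ∑ f ≡ ∑ g
  ∑-cong f≗g = sum-cong-≗ (f≗g ∘ E.from)

  ∑-closed : (P : Carrier → Set) → P 0# → (∀ {a b} → P a → P b → P (a + b)) →
             ∀ h → (∀ x → P (h x)) → P (∑ h)
  ∑-closed P P0 P+ h Ph = go (h ∘ E.from) (Ph ∘ E.from)
    where
    go : ∀ {k} (t : Vector Carrier k) → (∀ i → P (t i)) → P (sum t)
    go {zero}  t Pt = P0
    go {suc k} t Pt = P+ (Pt Fin.zero) (go (t ∘ Fin.suc) (Pt ∘ Fin.suc))

-- The canonical morphism ℤ → R lets the ring solver use integer coefficients
-- in any commutative ring R whose equality is propositional.
module IntegerRingSolver {A : Set} {+ᴬ *ᴬ : Op₂ A} { -ᴬ : Op₁ A} {0ᴬ 1ᴬ : A}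
  (isCommutativeRing : IsCommutativeRing _≡_ +ᴬ *ᴬ -ᴬ 0ᴬ 1ᴬ) where

  ring : CommutativeRing 0ℓ 0ℓ
  ring = record { isCommutativeRing = isCommutativeRing }

  open CommutativeRing ring using (Carrier; _+_; _*_; -_; 0#; 1#; semiring; _-_; +-identityˡ; +-identityʳ; +-comm; +-assoc; -‿inverseʳ; zeroˡ)
  open import Algebra.Properties.Ring (CommutativeRing.ring ring)
    using (-0#≈0#; -‿distribˡ-*; -‿distribʳ-*; -‿involutive; -‿+-comm)
  open import Algebra.Properties.Semiring.Mult semiring using (×-homo-+; ×1-homo-*) renaming (_×_ to _×ᴺ_)
  open ≡-Reasoning

  ι : ℤ → Carrier
  ι (ℤ.+ k)  = k ×ᴺ 1#
  ι -[1+ k ] = - (suc k ×ᴺ 1#)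

  private
    signed : Sign → Carrier → Carrier
    signed Sign.+ x = x
    signed Sign.- x = - x

    ι-◃ : ∀ s k → ι (s ℤ.◃ k) ≡ signed s (k ×ᴺ 1#)
    ι-◃ Sign.+ zero    = refl
    ι-◃ Sign.- zero    = sym -0#≈0#
    ι-◃ Sign.+ (suc k) = refl
    ι-◃ Sign.- (suc k) = refl

    ι-signAbs : ∀ i → ι i ≡ signed (ℤ.sign i) (ℤ.∣ i ∣ ×ᴺ 1#)
    ι-signAbs (ℤ.+ k)  = refl
    ι-signAbs -[1+ k ] = refl

    signed-* : ∀ s t x y → signed (s Sign.* t) (x * y) ≡ signed s x * signed t y
    signed-* Sign.+ Sign.+ x y = refl
    signed-* Sign.+ Sign.- x y = -‿distribʳ-* x y
    signed-* Sign.- Sign.+ x y = -‿distribˡ-* x y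
    signed-* Sign.- Sign.- x y = begin
      x * y         ≡⟨ -‿involutive (x * y) ⟨
      - - (x * y)   ≡⟨ cong -_ (-‿distribˡ-* x y) ⟩
      - (- x * y)   ≡⟨ -‿distribʳ-* (- x) y ⟩
      - x * - y     ∎

    ι-⊖ : ∀ a b → ι (a ⊖ b) ≡ a ×ᴺ 1# - b ×ᴺ 1#
    ι-⊖ zero    zero    = sym (trans (+-identityˡ _) -0#≈0#)
    ι-⊖ (suc a) zero    = sym (trans (cong ((suc a ×ᴺ 1#) +_) -0#≈0#) (+-identityʳ _))
    ι-⊖ zero    (suc b) = sym (+-identityˡ _)
    ι-⊖ (suc a) (suc b) = begin
      ι (suc a ⊖ suc b)                  ≡⟨ cong ι (ℤ.[1+m]⊖[1+n]≡m⊖n a b) ⟩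
      ι (a ⊖ b)                          ≡⟨ ι-⊖ a b ⟩
      a ×ᴺ 1# - b ×ᴺ 1#                  ≡⟨ cancel 1# (a ×ᴺ 1#) (b ×ᴺ 1#) ⟨
      (1# + a ×ᴺ 1#) - (1# + b ×ᴺ 1#)    ∎
      where
      cancel : ∀ u x y → (u + x) - (u + y) ≡ x - y
      cancel u x y = begin
        (u + x) + - (u + y)      ≡⟨ cong ((u + x) +_) (-‿+-comm u y) ⟨
        (u + x) + (- u + - y)    ≡⟨ +-assoc u x _ ⟩
        u + (x + (- u + - y))    ≡⟨ cong (u +_) (trans (+-comm x _) (+-assoc (- u) (- y) x)) ⟩
        u + (- u + (- y + x))    ≡⟨ +-assoc u (- u) _ ⟨
        (u + - u) + (- y + x)    ≡⟨ cong (_+ (- y + x)) (-‿inverseʳ u) ⟩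
        0# + (- y + x)           ≡⟨ trans (+-identityˡ _) (+-comm _ _) ⟩
        x - y                    ∎

  ι-+ : ∀ i j → ι (i ℤ.+ j) ≡ ι i + ι j
  ι-+ (ℤ.+ a)  (ℤ.+ b)  = ×-homo-+ 1# a b
  ι-+ (ℤ.+ a)  -[1+ b ] = ι-⊖ a (suc b)
  ι-+ -[1+ a ] (ℤ.+ b)  = trans (ι-⊖ b (suc a)) (+-comm _ _)
  ι-+ -[1+ a ] -[1+ b ] = begin
    - (suc (suc (a ℕ.+ b)) ×ᴺ 1#)        ≡⟨ cong (λ k → - (k ×ᴺ 1#)) (ℕ.+-suc (suc a) b) ⟨
    - ((suc a ℕ.+ suc b) ×ᴺ 1#)          ≡⟨ cong -_ (×-homo-+ 1# (suc a) (suc b)) ⟩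
    - (suc a ×ᴺ 1# + suc b ×ᴺ 1#)        ≡⟨ -‿+-comm _ _ ⟨
    - (suc a ×ᴺ 1#) + - (suc b ×ᴺ 1#)    ∎

  ι-* : ∀ i j → ι (i ℤ.* j) ≡ ι i * ι j
  ι-* i j = begin
    ι (i ℤ.* j)                                  ≡⟨ ι-◃ s (ℤ.∣ i ∣ ℕ.* ℤ.∣ j ∣) ⟩
    signed s ((ℤ.∣ i ∣ ℕ.* ℤ.∣ j ∣) ×ᴺ 1#)       ≡⟨ cong (signed s) (×1-homo-* ℤ.∣ i ∣ ℤ.∣ j ∣) ⟩
    signed s (ℤ.∣ i ∣ ×ᴺ 1# * ℤ.∣ j ∣ ×ᴺ 1#)     ≡⟨ signed-* (ℤ.sign i) (ℤ.sign j) _ _ ⟩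
    signed (ℤ.sign i) (ℤ.∣ i ∣ ×ᴺ 1#) * signed (ℤ.sign j) (ℤ.∣ j ∣ ×ᴺ 1#)
                                                 ≡⟨ cong₂ _*_ (ι-signAbs i) (ι-signAbs j) ⟨
    ι i * ι j                                    ∎
    where s = ℤ.sign i Sign.* ℤ.sign j

  ι-‿ : ∀ i → ι (ℤ.- i) ≡ - ι i
  ι-‿ (ℤ.+ zero)  = sym -0#≈0#
  ι-‿ (ℤ.+ suc k) = refl
  ι-‿ -[1+ k ]    = sym (-‿involutive _)

  private
    ℤ-rawRing : RawRing 0ℓ 0ℓ
    ℤ-rawRing = record
      { Carrier = ℤ ; _≈_ = _≡_ ; _+_ = ℤ._+_ ; _*_ = ℤ._*_ ; -_ = ℤ.-_ ; 0# = ℤ.+ 0 ; 1# = ℤ.+ 1 }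

    ι-morphism : ℤ-rawRing ACR.-Raw-AlmostCommutative⟶ ACR.fromCommutativeRing ring
    ι-morphism = record
      { ⟦_⟧ = ι ; +-homo = ι-+ ; *-homo = ι-* ; -‿homo = ι-‿ ; 0-homo = refl ; 1-homo = +-identityʳ 1# }

  open Algebra.Solver.Ring ℤ-rawRing (ACR.fromCommutativeRing ring) ι-morphism
         (λ i j → Maybe.map (cong ι) (dec⇒weaklyDec ℤ._≟_ i j)) public
    using (solve; _:+_; _:*_; _:-_; :-_; _:=_; con)

module FiniteFieldProperties {n : ℕ} (F : FiniteField n) where

  open IntegerRingSolver (FiniteField.isCommutativeRing F) public
  open CommutativeRing ring public hiding (refl; sym; trans; ring)
  open import Algebra.Properties.Ring (CommutativeRing.ring ring) public
  open import Algebra.Properties.Semiring.Mult semiring public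
    using (×-assoc-*; ×1-homo-*) renaming (_×_ to _×ᴺ_)
  open import Algebra.Properties.Semiring.Exp semiring public using (_^_; ^-assocʳ)
  open import Algebra.Properties.CommutativeSemiring.Exp commutativeSemiring public using (^-distrib-*)
  import Algebra.Properties.CommutativeSemiring.Binomial commutativeSemiring as Binomial
  module Additive       = FiniteSum (FiniteField.enumeration F) +-commutativeMonoid
  module Multiplicative = FiniteSum (FiniteField.enumeration F) *-commutativeMonoid
  open Multiplicative using () renaming (∑ to ∏)
  open ≡-Reasoning

  private module E = Inverse (FiniteField.enumeration F)

  ^ᶠ≗^ : ∀ x k → FiniteField._^_ F x k ≡ x ^ k
  ^ᶠ≗^ x zero    = refl
  ^ᶠ≗^ x (suc k) = cong (x *_) (^ᶠ≗^ x k)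

  infix 4 _≟_
  _≟_ : DecidableEquality Carrier
  x ≟ y = Dec.map′ to-injective (cong E.to) (E.to x Fin.≟ E.to y)
    where
    to-injective : E.to x ≡ E.to y → x ≡ y
    to-injective eq = trans (sym (E.strictlyInverseʳ x)) (trans (cong E.from eq) (E.strictlyInverseʳ y))

  elements : List Carrier
  elements = tabulate E.from

  elements-unique : Unique elements
  elements-unique = Uniqueₚ.tabulate⁺ λ {i} {j} eq →
    trans (sym (E.strictlyInverseˡ i)) (trans (cong E.to eq) (E.strictlyInverseˡ j))

  ∈-elements : ∀ x → x ∈ elements
  ∈-elements x = subst (_∈ elements) (E.strictlyInverseʳ x) (∈ₚ.∈-tabulate⁺ (E.to x))

  length-elements : length elements ≡ n
  length-elements = length-tabulate E.from

  0≢1 : 0# ≢ 1#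
  0≢1 = FiniteField.0≢1 F

  n≢0 : n ≢ 0
  n≢0 refl = contradiction (E.to 0#) λ ()

  inv : ∀ x → x ≢ 0# → Carrier
  inv x x≢0 = proj₁ (FiniteField.inverse F x x≢0)

  *-invʳ : ∀ x (x≢0 : x ≢ 0#) → x * inv x x≢0 ≡ 1#
  *-invʳ x x≢0 = proj₂ (FiniteField.inverse F x x≢0)

  *-invˡ : ∀ x (x≢0 : x ≢ 0#) → inv x x≢0 * x ≡ 1#
  *-invˡ x x≢0 = trans (*-comm _ x) (*-invʳ x x≢0)

  inv-nonzero : ∀ x (x≢0 : x ≢ 0#) → inv x x≢0 ≢ 0#
  inv-nonzero x x≢0 x⁻¹≡0 = 0≢1 (begin
    0#              ≡⟨ zeroˡ x ⟨
    0# * x          ≡⟨ cong (_* x) x⁻¹≡0 ⟨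
    inv x x≢0 * x   ≡⟨ *-invˡ x x≢0 ⟩
    1#              ∎)

  *-cancelʳ-nonzero : ∀ {a b} c → c ≢ 0# → a * c ≡ b * c → a ≡ b
  *-cancelʳ-nonzero {a} {b} c c≢0 ac≡bc = begin
    a                ≡⟨ *-identityʳ a ⟨
    a * 1#           ≡⟨ cong (a *_) (*-invʳ c c≢0) ⟨
    a * (c * c⁻¹)    ≡⟨ *-assoc a c c⁻¹ ⟨
    (a * c) * c⁻¹    ≡⟨ cong (_* c⁻¹) ac≡bc ⟩
    (b * c) * c⁻¹    ≡⟨ *-assoc b c c⁻¹ ⟩
    b * (c * c⁻¹)    ≡⟨ cong (b *_) (*-invʳ c c≢0) ⟩
    b * 1#           ≡⟨ *-identityʳ b ⟩
    b                ∎
    where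
    c⁻¹ : Carrier
    c⁻¹ = inv c c≢0

  *-cancelˡ-nonzero : ∀ {a b} c → c ≢ 0# → c * a ≡ c * b → a ≡ b
  *-cancelˡ-nonzero {a} {b} c c≢0 eq = *-cancelʳ-nonzero c c≢0 (trans (*-comm a c) (trans eq (*-comm c b)))

  *-nonzero : ∀ {x y} → x ≢ 0# → y ≢ 0# → x * y ≢ 0#
  *-nonzero {x} x≢0 y≢0 xy≡0 = y≢0 (*-cancelˡ-nonzero x x≢0 (trans xy≡0 (sym (zeroʳ x))))

  ^-nonzero : ∀ {x} k → x ≢ 0# → x ^ k ≢ 0#
  ^-nonzero zero    x≢0 = 0≢1 ∘ sym
  ^-nonzero (suc k) x≢0 = *-nonzero x≢0 (^-nonzero k x≢0)

  ^≡0⇒≡0 : ∀ {x} k → x ^ k ≡ 0# → x ≡ 0#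
  ^≡0⇒≡0 {x} k xᵏ≡0 = Dec.decidable-stable (x ≟ 0#) (λ x≢0 → ^-nonzero k x≢0 xᵏ≡0)

  1^ : ∀ k → 1# ^ k ≡ 1#
  1^ zero    = refl
  1^ (suc k) = trans (*-identityˡ _) (1^ k)

  x-y≡0⇒x≡y : ∀ {x y} → x - y ≡ 0# → x ≡ y
  x-y≡0⇒x≡y {x} {y} x-y≡0 = begin
    x              ≡⟨ solve 2 (λ x y → x := (x :- y) :+ y) refl x y ⟩
    (x - y) + y    ≡⟨ cong (_+ y) x-y≡0 ⟩
    0# + y         ≡⟨ +-identityˡ y ⟩
    y              ∎

  x≡y⇒x-y≡0 : ∀ {x y} → x ≡ y → x - y ≡ 0#
  x≡y⇒x-y≡0 {x} refl = -‿inverseʳ x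

  -- Characteristic, Fermat and Frobenius

  translation : Carrier → Carrier ↔ Carrier
  translation a = mk↔ₛ′ (a +_) (_- a)
    (λ y → solve 2 (λ a y → a :+ (y :- a) := y) refl a y)
    (λ y → solve 2 (λ a y → (a :+ y) :- a := y) refl a y)

  scaling : ∀ u → u ≢ 0# → Carrier ↔ Carrier
  scaling u u≢0 = mk↔ₛ′ (u *_) (inv u u≢0 *_)
    (λ y → trans (sym (*-assoc _ _ _)) (trans (cong (_* y) (*-invʳ u u≢0)) (*-identityˡ y)))
    (λ y → trans (sym (*-assoc _ _ _)) (trans (cong (_* y) (*-invˡ u u≢0)) (*-identityˡ y)))

  -- Translation by 1# permutes the field, so ∑ x = ∑ (1 + x) = n·1 + ∑ x.
  n×1≡0 : n ×ᴺ 1# ≡ 0#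
  n×1≡0 = begin
    n ×ᴺ 1#                   ≡⟨ solve 2 (λ a s → a := (a :+ s) :- s) refl (n ×ᴺ 1#) Σ ⟩
    (n ×ᴺ 1# + Σ) - Σ         ≡⟨ cong (λ a → (a + Σ) - Σ) (Additive.∑-const 1#) ⟨
    (Additive.∑ (λ _ → 1#) + Σ) - Σ
                              ≡⟨ cong (_- Σ) (Additive.∑-distrib (λ _ → 1#) (λ x → x)) ⟨
    Additive.∑ (1# +_) - Σ    ≡⟨ cong (_- Σ) (Additive.∑-reindex (translation 1#) (λ x → x)) ⟨
    Σ - Σ                     ≡⟨ -‿inverseʳ Σ ⟩
    0#                        ∎
    where
    Σ : Carrier
    Σ = Additive.∑ (λ x → x)

  private
    avoid0 : Carrier → Carrier
    avoid0 y with y ≟ 0#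
    ... | yes _ = 1#
    ... | no  _ = y

    avoid0-nonzero : ∀ y → avoid0 y ≢ 0#
    avoid0-nonzero y with y ≟ 0#
    ... | yes _   = 0≢1 ∘ sym
    ... | no  y≢0 = y≢0

    defect : Carrier → Carrier → Carrier
    defect u y with y ≟ 0#
    ... | yes _ = u
    ... | no  _ = 1#

    scale-avoid0 : ∀ {u} → u ≢ 0# → ∀ y → u * avoid0 y ≡ avoid0 (u * y) * defect u y
    scale-avoid0 {u} u≢0 y with y ≟ 0# | u * y ≟ 0#
    ... | yes _   | yes _    = trans (*-identityʳ u) (sym (*-identityˡ u))
    ... | yes y≡0 | no uy≢0  = contradiction (trans (cong (u *_) y≡0) (zeroʳ u)) uy≢0
    ... | no  y≢0 | yes uy≡0 = contradiction uy≡0 (*-nonzero u≢0 y≢0)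
    ... | no  _   | no  _    = sym (*-identityʳ _)

    defect-single : ∀ u y → y ≢ 0# → defect u y ≡ 1#
    defect-single u y y≢0 with y ≟ 0#
    ... | yes y≡0 = contradiction y≡0 y≢0
    ... | no  _   = refl

    defect-0 : ∀ u → defect u 0# ≡ u
    defect-0 u with 0# ≟ 0#
    ... | yes _   = refl
    ... | no  0≢0 = contradiction refl 0≢0

  -- Scaling by a unit u permutes F, and avoid0 (u y) = u · avoid0 y except at
  -- y = 0, so comparing the two products of avoid0 gives uⁿ = u.
  fermat-unit : ∀ u → u ≢ 0# → u ^ n ≡ u
  fermat-unit u u≢0 = *-cancelʳ-nonzero P (Multiplicative.∑-closed (_≢ 0#) (0≢1 ∘ sym) *-nonzero avoid0 avoid0-nonzero) (begin
    u ^ n * P                                      ≡⟨ cong (_* P) (Multiplicative.∑-const u) ⟨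
    ∏ (λ _ → u) * P                                ≡⟨ Multiplicative.∑-distrib (λ _ → u) avoid0 ⟨
    ∏ (λ y → u * avoid0 y)                         ≡⟨ Multiplicative.∑-cong (scale-avoid0 u≢0) ⟩
    ∏ (λ y → avoid0 (u * y) * defect u y)          ≡⟨ Multiplicative.∑-distrib (avoid0 ∘ (u *_)) (defect u) ⟩
    ∏ (avoid0 ∘ (u *_)) * ∏ (defect u)             ≡⟨ cong₂ _*_ (Multiplicative.∑-reindex (scaling u u≢0) avoid0) (sym ∏defect) ⟨
    P * u                                          ≡⟨ *-comm P u ⟩
    u * P                                          ∎)
    where
    P : Carrier
    P = ∏ avoid0
    ∏defect : ∏ (defect u) ≡ u
    ∏defect = trans (Multiplicative.∑-single (defect u) 0# (defect-single u)) (defect-0 u)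

  fermat : ∀ x → x ^ n ≡ x
  fermat x with x ≟ 0#
  ... | yes refl = subst (λ k → 0# ^ k ≡ 0#) (ℕ.suc-pred n {{ℕ.≢-nonZero n≢0}}) (zeroˡ _)
  ... | no  x≢0  = fermat-unit x x≢0

  ×1-homo-^ : ∀ a b → (a ℕ.^ b) ×ᴺ 1# ≡ (a ×ᴺ 1#) ^ b
  ×1-homo-^ a zero    = +-identityʳ 1#
  ×1-homo-^ a (suc b) = trans (×1-homo-* a (a ℕ.^ b)) (cong (a ×ᴺ 1# *_) (×1-homo-^ a b))

  n≡m^k⇒m×1≡0 : ∀ m k → n ≡ m ℕ.^ k → m ×ᴺ 1# ≡ 0#
  n≡m^k⇒m×1≡0 m k n≡m^k = ^≡0⇒≡0 k (begin
    (m ×ᴺ 1#) ^ k      ≡⟨ ×1-homo-^ m k ⟨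
    (m ℕ.^ k) ×ᴺ 1#    ≡⟨ cong (_×ᴺ 1#) n≡m^k ⟨
    n ×ᴺ 1#            ≡⟨ n×1≡0 ⟩
    0#                 ∎)

  p×1≡0⇒[c*p]×t≡0 : ∀ {p} → p ×ᴺ 1# ≡ 0# → ∀ c t → (c ℕ.* p) ×ᴺ t ≡ 0#
  p×1≡0⇒[c*p]×t≡0 {p} p×1≡0 c t = begin
    (c ℕ.* p) ×ᴺ t                     ≡⟨ cong ((c ℕ.* p) ×ᴺ_) (*-identityˡ t) ⟨
    (c ℕ.* p) ×ᴺ (1# * t)              ≡⟨ ×-assoc-* (c ℕ.* p) 1# t ⟨
    (c ℕ.* p) ×ᴺ 1# * t                ≡⟨ cong (_* t) (×1-homo-* c p) ⟩
    (c ×ᴺ 1# * p ×ᴺ 1#) * t            ≡⟨ cong (λ z → (c ×ᴺ 1# * z) * t) p×1≡0 ⟩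
    (c ×ᴺ 1# * 0#) * t                 ≡⟨ cong (_* t) (zeroʳ _) ⟩
    0# * t                             ≡⟨ zeroˡ t ⟩
    0#                                 ∎

  -- The binomial coefficients p C k with 0 < k < p are multiples of p.
  frobenius : ∀ {p} → Prime p → p ×ᴺ 1# ≡ 0# → ∀ x y → (x + y) ^ p ≡ x ^ p + y ^ p
  frobenius {p@(suc j)} p-prime p×1≡0 x y = begin
    (x + y) ^ p                                ≡⟨ Binomial.theorem p x y ⟩
    Binomial.binomialExpansion x y p           ≡⟨ cong (term Fin.zero +_) (sum-single +-commutativeMonoid (term ∘ Fin.suc) (fromℕ j) middle-vanishes) ⟩
    term Fin.zero + term (fromℕ p)             ≡⟨ cong₂ _+_ (trans (+-identityʳ _) (*-identityˡ _)) (last (toℕ (fromℕ p)) (Fin.toℕ-fromℕ p)) ⟩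
    y ^ p + x ^ p                              ≡⟨ +-comm _ _ ⟩
    x ^ p + y ^ p                              ∎
    where
    term : Fin (suc p) → Carrier
    term = Binomial.binomialTerm x y p
    middle-vanishes : ∀ i → i ≢ fromℕ j → term (Fin.suc i) ≡ 0#
    middle-vanishes i i≢j with prime∣pCk p-prime (s≤s z≤n) (s≤s (subst (toℕ i <_) (Fin.toℕ-fromℕ j) (Fin.≤∧≢⇒< (Fin.≤fromℕ i) i≢j)))
    ... | divides c pCk≡c*p = trans (cong (_×ᴺ Binomial.binomial x y p (Fin.suc i)) pCk≡c*p) (p×1≡0⇒[c*p]×t≡0 p×1≡0 c _)
    last : ∀ m → m ≡ p → (p C m) ×ᴺ (x ^ m * y ^ (p ℕ.∸ m)) ≡ x ^ p
    last m refl = begin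
      (p C p) ×ᴺ (x ^ p * y ^ (p ℕ.∸ p))       ≡⟨ cong₂ (λ a b → a ×ᴺ (x ^ p * y ^ b)) (nCn≡1 p) (ℕ.n∸n≡0 p) ⟩
      1 ×ᴺ (x ^ p * 1#)                        ≡⟨ trans (+-identityʳ _) (*-identityʳ _) ⟩
      x ^ p                                    ∎

  frobenius-^ : ∀ {p} → Prime p → p ×ᴺ 1# ≡ 0# → ∀ k x y →
                (x + y) ^ (p ℕ.^ k) ≡ x ^ (p ℕ.^ k) + y ^ (p ℕ.^ k)
  frobenius-^ _ _ zero x y =
    trans (*-identityʳ (x + y)) (sym (cong₂ _+_ (*-identityʳ x) (*-identityʳ y)))
  frobenius-^ {p} p-prime p×1≡0 (suc k) x y = begin
    (x + y) ^ (p ℕ.* pᵏ)                ≡⟨ ^-assocʳ (x + y) p pᵏ ⟨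
    ((x + y) ^ p) ^ pᵏ                  ≡⟨ cong (_^ pᵏ) (frobenius p-prime p×1≡0 x y) ⟩
    (x ^ p + y ^ p) ^ pᵏ                ≡⟨ frobenius-^ p-prime p×1≡0 k (x ^ p) (y ^ p) ⟩
    (x ^ p) ^ pᵏ + (y ^ p) ^ pᵏ         ≡⟨ cong₂ _+_ (^-assocʳ x p pᵏ) (^-assocʳ y p pᵏ) ⟩
    x ^ (p ℕ.* pᵏ) + y ^ (p ℕ.* pᵏ)     ∎
    where
    pᵏ : ℕ
    pᵏ = p ℕ.^ k

  -- Roots of polynomials

  -- The coefficient list c₀ ∷ c₁ ∷ … ∷ c_{d-1} stands for the monic polynomial
  -- c₀ + c₁ X + … + c_{d-1} X^(d-1) + X^d of degree d = length of the list.
  evalMonic : List Carrier → Carrier → Carrier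
  evalMonic []       x = 1#
  evalMonic (c ∷ cs) x = c + x * evalMonic cs x

  evalMonic-replicate-0 : ∀ k x → evalMonic (replicate k 0#) x ≡ x ^ k
  evalMonic-replicate-0 zero    x = refl
  evalMonic-replicate-0 (suc k) x = trans (+-identityˡ _) (cong (x *_) (evalMonic-replicate-0 k x))

  -- Synthetic division by X - a.
  quotientBy : Carrier → List Carrier → List Carrier
  quotientBy a []                 = []
  quotientBy a (c ∷ [])           = []
  quotientBy a (c ∷ cs@(_ ∷ _))   = evalMonic cs a ∷ quotientBy a cs

  length-quotientBy : ∀ a c cs → length (quotientBy a (c ∷ cs)) ≡ length cs
  length-quotientBy a c []        = refl
  length-quotientBy a c (c′ ∷ cs) = cong suc (length-quotientBy a c′ cs)

  evalMonic-quotientBy : ∀ a c cs x →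
    evalMonic (c ∷ cs) x ≡ (x - a) * evalMonic (quotientBy a (c ∷ cs)) x + evalMonic (c ∷ cs) a
  evalMonic-quotientBy a c [] x =
    solve 4 (λ a c x o → c :+ x :* o := (x :- a) :* o :+ (c :+ a :* o)) refl a c x 1#
  evalMonic-quotientBy a c (c′ ∷ cs) x = begin
    c + x * E x                     ≡⟨ cong (λ z → c + x * z) (evalMonic-quotientBy a c′ cs x) ⟩
    c + x * ((x - a) * D + E a)     ≡⟨ solve 5 (λ a c x d e → c :+ x :* ((x :- a) :* d :+ e) := (x :- a) :* (e :+ x :* d) :+ (c :+ a :* e)) refl a c x D (E a) ⟩
    (x - a) * (E a + x * D) + (c + a * E a) ∎
    where
    E : Carrier → Carrier
    E = evalMonic (c′ ∷ cs)
    D : Carrier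
    D = evalMonic (quotientBy a (c′ ∷ cs)) x

  roots≤degree : ∀ cs rs → Unique rs → All (λ r → evalMonic cs r ≡ 0#) rs → length rs ≤ length cs
  roots≤degree cs       []       _          _             = z≤n
  roots≤degree []       (r ∷ rs) _          (1≡0 ∷ _)     = contradiction (sym 1≡0) 0≢1
  roots≤degree (c ∷ cs) (r ∷ rs) (r∉ ∷ rs!) (root ∷ roots) =
    subst (λ d → suc (length rs) ≤ suc d) (length-quotientBy r c cs)
      (s≤s (roots≤degree (quotientBy r (c ∷ cs)) rs rs! (All.zipWith (uncurry remaining-root) (r∉ , roots))))
    where
    remaining-root : ∀ {s} → r ≢ s → evalMonic (c ∷ cs) s ≡ 0# → evalMonic (quotientBy r (c ∷ cs)) s ≡ 0#
    remaining-root {s} r≢s root-s = *-cancelˡ-nonzero (s - r) (λ s-r≡0 → r≢s (sym (x-y≡0⇒x≡y s-r≡0))) (begin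
      (s - r) * quot                                ≡⟨ +-identityʳ _ ⟨
      (s - r) * quot + 0#                           ≡⟨ cong ((s - r) * quot +_) root ⟨
      (s - r) * quot + evalMonic (c ∷ cs) r         ≡⟨ evalMonic-quotientBy r c cs s ⟨
      evalMonic (c ∷ cs) s                       ≡⟨ root-s ⟩
      0#                                         ≡⟨ zeroʳ _ ⟨
      (s - r) * 0#                               ∎)
      where
      quot : Carrier
      quot = evalMonic (quotientBy r (c ∷ cs)) s

module QuadraticExtension {q k : ℕ} (q-prime-power : IsPrimePower q) (k≥1 : k ≥ 1)
                          (F : FiniteField (q ℕ.^ (2 ℕ.* k))) where

  open FiniteFieldProperties F
  open ≡-Reasoning

  Q : ℕ
  Q = q ℕ.^ k

  private
    p e : ℕ
    p = proj₁ q-prime-power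
    e = proj₁ (proj₂ q-prime-power)

    p-prime : Prime p
    p-prime = proj₁ (proj₂ (proj₂ q-prime-power))

    e≥1 : e ≥ 1
    e≥1 = proj₁ (proj₂ (proj₂ (proj₂ q-prime-power)))

    q≡p^e : q ≡ p ℕ.^ e
    q≡p^e = proj₂ (proj₂ (proj₂ (proj₂ q-prime-power)))

    Q≡p^ek : Q ≡ p ℕ.^ (e ℕ.* k)
    Q≡p^ek = trans (cong (ℕ._^ k) q≡p^e) (ℕ.^-*-assoc p e k)

    |F|≡Q*Q : q ℕ.^ (2 ℕ.* k) ≡ Q ℕ.* Q
    |F|≡Q*Q = trans (ℕ.^-distribˡ-+-* q k (k ℕ.+ 0)) (cong (λ i → Q ℕ.* q ℕ.^ i) (ℕ.+-identityʳ k))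

    Q≥2 : Q ≥ 2
    Q≥2 = subst (_≥ 2) (sym Q≡p^ek) (2≤m⇒1≤n⇒2≤m^n (ℕ.nonTrivial⇒n>1 p {{prime⇒nonTrivial p-prime}}) (ℕ.*-mono-≤ e≥1 k≥1))

    Q-2 : ℕ
    Q-2 = Q ℕ.∸ 2

    Q≡2+[Q-2] : Q ≡ 2 ℕ.+ Q-2
    Q≡2+[Q-2] = sym (ℕ.m+[n∸m]≡n Q≥2)

    p×1≡0 : p ×ᴺ 1# ≡ 0#
    p×1≡0 = n≡m^k⇒m×1≡0 p (e ℕ.* k ℕ.+ e ℕ.* k)
      (trans |F|≡Q*Q (trans (cong₂ ℕ._*_ Q≡p^ek Q≡p^ek) (sym (ℕ.^-distribˡ-+-* p (e ℕ.* k) (e ℕ.* k)))))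

  conj : Carrier → Carrier
  conj x = x ^ Q

  conj-+ : ∀ x y → conj (x + y) ≡ conj x + conj y
  conj-+ x y = begin
    (x + y) ^ Q                          ≡⟨ cong ((x + y) ^_) Q≡p^ek ⟩
    (x + y) ^ p ℕ.^ (e ℕ.* k)            ≡⟨ frobenius-^ p-prime p×1≡0 (e ℕ.* k) x y ⟩
    x ^ p ℕ.^ (e ℕ.* k) + y ^ p ℕ.^ (e ℕ.* k)
                                         ≡⟨ cong₂ (λ i j → x ^ i + y ^ j) Q≡p^ek Q≡p^ek ⟨
    x ^ Q + y ^ Q                        ∎

  conj-* : ∀ x y → conj (x * y) ≡ conj x * conj y
  conj-* x y = ^-distrib-* x y Q

  conj-0 : conj 0# ≡ 0#
  conj-0 = subst (λ i → 0# ^ i ≡ 0#) (sym Q≡2+[Q-2]) (zeroˡ _)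

  conj-1 : conj 1# ≡ 1#
  conj-1 = 1^ Q

  conj-‿ : ∀ x → conj (- x) ≡ - conj x
  conj-‿ x = begin
    conj (- x)                       ≡⟨ solve 2 (λ a b → b := (a :+ b) :- a) refl (conj x) (conj (- x)) ⟩
    (conj x + conj (- x)) - conj x   ≡⟨ cong (_- conj x) (conj-+ x (- x)) ⟨
    conj (x + - x) - conj x          ≡⟨ cong (λ z → conj z - conj x) (-‿inverseʳ x) ⟩
    conj 0# - conj x                 ≡⟨ cong (_- conj x) conj-0 ⟩
    0# - conj x                      ≡⟨ +-identityˡ _ ⟩
    - conj x                         ∎

  conj-- : ∀ x y → conj (x - y) ≡ conj x - conj y
  conj-- x y = trans (conj-+ x (- y)) (cong (conj x +_) (conj-‿ y))

  conj-involutive : ∀ x → conj (conj x) ≡ x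
  conj-involutive x = begin
    (x ^ Q) ^ Q          ≡⟨ ^-assocʳ x Q Q ⟩
    x ^ (Q ℕ.* Q)        ≡⟨ cong (x ^_) |F|≡Q*Q ⟨
    x ^ q ℕ.^ (2 ℕ.* k)  ≡⟨ fermat x ⟩
    x                    ∎

  -- The subfield K of conjugation-fixed elements

  Fixed : Carrier → Set
  Fixed x = conj x ≡ x

  fixed? : ∀ x → Dec (Fixed x)
  fixed? x = conj x ≟ x

  fixedPoints : List Carrier
  fixedPoints = filter fixed? elements

  fixedPoints-unique : Unique fixedPoints
  fixedPoints-unique = Uniqueₚ.filter⁺ fixed? elements-unique

  ∈-fixedPoints : ∀ {x} → Fixed x → x ∈ fixedPoints
  ∈-fixedPoints {x} fx = ∈ₚ.∈-filter⁺ fixed? (∈-elements x) fx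

  fixedPoints-fixed : All Fixed fixedPoints
  fixedPoints-fixed = Allₚ.all-filter fixed? elements

  -- The fixed points are roots of X^Q - X.
  length-fixedPoints≤Q : length fixedPoints ≤ Q
  length-fixedPoints≤Q = subst (length fixedPoints ≤_) degree
    (roots≤degree X^Q-X fixedPoints fixedPoints-unique (All.map (λ {x} → root x) fixedPoints-fixed))
    where
    X^Q-X : List Carrier
    X^Q-X = 0# ∷ - 1# ∷ replicate Q-2 0#
    degree : length X^Q-X ≡ Q
    degree = trans (cong (suc ∘ suc) (length-replicate Q-2)) (sym Q≡2+[Q-2])
    root : ∀ x → Fixed x → evalMonic X^Q-X x ≡ 0#
    root x fx = begin
      0# + x * (- 1# + x * evalMonic (replicate Q-2 0#) x)
                                   ≡⟨ cong (λ z → 0# + x * (- 1# + x * z)) (evalMonic-replicate-0 Q-2 x) ⟩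
      0# + x * (- 1# + x * x ^ Q-2)
                                   ≡⟨ solve 3 (λ x o t → con (ℤ.+ 0) :+ x :* (:- o :+ x :* t) := x :* (x :* t) :- x :* o) refl x 1# (x ^ Q-2) ⟩
      x ^ (2 ℕ.+ Q-2) - x * 1#     ≡⟨ cong₂ (λ i z → x ^ i - z) (sym Q≡2+[Q-2]) (*-identityʳ x) ⟩
      conj x - x                   ≡⟨ x≡y⇒x-y≡0 fx ⟩
      0#                           ∎

  nonFixed : ∃ λ ω → ¬ Fixed ω
  nonFixed with Any.any? (¬? ∘ fixed?) elements
  ... | yes some = Any.satisfied some
  ... | no  none = contradiction Q*Q≤Q (ℕ.<⇒≱ (ℕ.m<m*n Q Q {{ℕ.>-nonZero (ℕ.≤-trans (s≤s z≤n) Q≥2)}} Q≥2))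
    where
    all-fixed : All Fixed elements
    all-fixed = All.map (Dec.decidable-stable (fixed? _)) (Allₚ.¬Any⇒All¬ elements none)
    Q*Q≤Q : Q ℕ.* Q ≤ Q
    Q*Q≤Q = subst (_≤ Q) (trans (cong length (filter-all fixed? all-fixed)) (trans length-elements |F|≡Q*Q)) length-fixedPoints≤Q

  -- F = K ⊕ K ω

  private
    ω : Carrier
    ω = proj₁ nonFixed

    δ : Carrier
    δ = conj ω - ω

    δ≢0 : δ ≢ 0#
    δ≢0 = proj₂ nonFixed ∘ x-y≡0⇒x≡y

    δ⁻¹ : Carrier
    δ⁻¹ = inv δ δ≢0

    δ⁻¹δ≡1 : δ⁻¹ * δ ≡ 1#
    δ⁻¹δ≡1 = *-invˡ δ δ≢0

    conj-δ : conj δ ≡ - δ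
    conj-δ = begin
      conj (conj ω - ω)            ≡⟨ conj-- (conj ω) ω ⟩
      conj (conj ω) - conj ω       ≡⟨ cong (_- conj ω) (conj-involutive ω) ⟩
      ω - conj ω                   ≡⟨ solve 2 (λ a b → a :- b := :- (b :- a)) refl ω (conj ω) ⟩
      - δ                          ∎

    conj-δ⁻¹ : conj δ⁻¹ ≡ - δ⁻¹
    conj-δ⁻¹ = *-cancelʳ-nonzero δ δ≢0 (begin
      conj δ⁻¹ * δ                 ≡⟨ solve 2 (λ a b → a :* b := :- (a :* (:- b))) refl (conj δ⁻¹) δ ⟩
      - (conj δ⁻¹ * - δ)           ≡⟨ cong (λ z → - (conj δ⁻¹ * z)) conj-δ ⟨
      - (conj δ⁻¹ * conj δ)        ≡⟨ cong -_ (conj-* δ⁻¹ δ) ⟨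
      - conj (δ⁻¹ * δ)             ≡⟨ cong (-_ ∘ conj) δ⁻¹δ≡1 ⟩
      - conj 1#                    ≡⟨ cong -_ conj-1 ⟩
      - 1#                         ≡⟨ cong -_ δ⁻¹δ≡1 ⟨
      - (δ⁻¹ * δ)                  ≡⟨ -‿distribˡ-* δ⁻¹ δ ⟩
      - δ⁻¹ * δ                    ∎)

  im : Carrier → Carrier
  im x = (conj x - x) * δ⁻¹

  re : Carrier → Carrier
  re x = x - im x * ω

  im-fixed : ∀ x → Fixed (im x)
  im-fixed x = begin
    conj ((conj x - x) * δ⁻¹)             ≡⟨ conj-* (conj x - x) δ⁻¹ ⟩
    conj (conj x - x) * conj δ⁻¹          ≡⟨ cong₂ _*_ (conj-- (conj x) x) conj-δ⁻¹ ⟩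
    (conj (conj x) - conj x) * - δ⁻¹      ≡⟨ cong (λ z → (z - conj x) * - δ⁻¹) (conj-involutive x) ⟩
    (x - conj x) * - δ⁻¹                  ≡⟨ solve 3 (λ x a i → (x :- a) :* (:- i) := (a :- x) :* i) refl x (conj x) δ⁻¹ ⟩
    (conj x - x) * δ⁻¹                    ∎

  im[a+bω]≡b : ∀ a b → Fixed a → Fixed b → im (a + b * ω) ≡ b
  im[a+bω]≡b a b fa fb = begin
    (conj (a + b * ω) - (a + b * ω)) * δ⁻¹
                                     ≡⟨ cong (λ z → (z - (a + b * ω)) * δ⁻¹) (trans (conj-+ a (b * ω)) (cong (conj a +_) (conj-* b ω))) ⟩
    (conj a + conj b * conj ω - (a + b * ω)) * δ⁻¹
                                     ≡⟨ cong₂ (λ u v → (u + v * conj ω - (a + b * ω)) * δ⁻¹) fa fb ⟩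
    (a + b * conj ω - (a + b * ω)) * δ⁻¹
                                     ≡⟨ solve 5 (λ a b w o i → (a :+ b :* w :- (a :+ b :* o)) :* i := b :* (i :* (w :- o))) refl a b (conj ω) ω δ⁻¹ ⟩
    b * (δ⁻¹ * δ)                    ≡⟨ cong (b *_) δ⁻¹δ≡1 ⟩
    b * 1#                           ≡⟨ *-identityʳ b ⟩
    b                                ∎

  re[a+bω]≡a : ∀ a b → Fixed a → Fixed b → re (a + b * ω) ≡ a
  re[a+bω]≡a a b fa fb = begin
    (a + b * ω) - im (a + b * ω) * ω   ≡⟨ cong (λ z → (a + b * ω) - z * ω) (im[a+bω]≡b a b fa fb) ⟩
    (a + b * ω) - b * ω                ≡⟨ solve 2 (λ a t → (a :+ t) :- t := a) refl a (b * ω) ⟩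
    a                                  ∎

  re+im*ω : ∀ x → re x + im x * ω ≡ x
  re+im*ω x = solve 2 (λ x t → (x :- t) :+ t := x) refl x (im x * ω)

  re-fixed : ∀ x → Fixed (re x)
  re-fixed x = begin
    conj (x - im x * ω)                  ≡⟨ conj-- x (im x * ω) ⟩
    conj x - conj (im x * ω)             ≡⟨ cong (λ z → conj x - z) (trans (conj-* (im x) ω) (cong (_* conj ω) (im-fixed x))) ⟩
    conj x - im x * conj ω               ≡⟨ solve 5 (λ a x i w o → a :- ((a :- x) :* i) :* w := x :- ((a :- x) :* i) :* o :+ ((a :- x) :- (a :- x) :* (i :* (w :- o)))) refl (conj x) x δ⁻¹ (conj ω) ω ⟩
    re x + ((conj x - x) - (conj x - x) * (δ⁻¹ * δ))
                                         ≡⟨ cong (λ z → re x + ((conj x - x) - (conj x - x) * z)) δ⁻¹δ≡1 ⟩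
    re x + ((conj x - x) - (conj x - x) * 1#)
                                         ≡⟨ cong (λ z → re x + ((conj x - x) - z)) (*-identityʳ _) ⟩
    re x + ((conj x - x) - (conj x - x)) ≡⟨ cong (re x +_) (-‿inverseʳ _) ⟩
    re x + 0#                            ≡⟨ +-identityʳ _ ⟩
    re x                                 ∎

  fixed⇒im≡0 : ∀ {s} → Fixed s → im s ≡ 0#
  fixed⇒im≡0 fs = trans (cong (_* δ⁻¹) (x≡y⇒x-y≡0 fs)) (zeroˡ δ⁻¹)

  im≡0⇒fixed : ∀ {s} → im s ≡ 0# → Fixed s
  im≡0⇒fixed ims≡0 = x-y≡0⇒x≡y (*-cancelʳ-nonzero δ⁻¹ (inv-nonzero δ δ≢0) (trans ims≡0 (sym (zeroˡ δ⁻¹))))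

  im-- : ∀ y x → im (y - x) ≡ im y - im x
  im-- y x = begin
    (conj (y - x) - (y - x)) * δ⁻¹            ≡⟨ cong (λ t → (t - (y - x)) * δ⁻¹) (conj-- y x) ⟩
    ((conj y - conj x) - (y - x)) * δ⁻¹       ≡⟨ solve 5 (λ a b y x i → ((a :- b) :- (y :- x)) :* i := (a :- y) :* i :- (b :- x) :* i) refl (conj y) (conj x) y x δ⁻¹ ⟩
    im y - im x                               ∎

  |K| : ℕ
  |K| = length fixedPoints

  private
    fixed-lookup : ∀ i → Fixed (lookup fixedPoints i)
    fixed-lookup i = All.lookup fixedPoints-fixed (∈ₚ.∈-lookup i)

    index : ∀ {x} → Fixed x → Fin |K|
    index fx = Any.index (∈-fixedPoints fx)

    lookup-index : ∀ {x} (fx : Fixed x) → lookup fixedPoints (index fx) ≡ x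
    lookup-index fx = sym (Anyₚ.lookup-index (∈-fixedPoints fx))

    index-lookup : ∀ {x} (fx : Fixed x) i → lookup fixedPoints i ≡ x → index fx ≡ i
    index-lookup fx i eq = Unique⇒lookup-injective fixedPoints-unique _ i (trans (lookup-index fx) (sym eq))

    index≡⇒≡ : ∀ {x y} (fx : Fixed x) (fy : Fixed y) → index fx ≡ index fy → x ≡ y
    index≡⇒≡ fx fy = index-injective (≡.setoid Carrier) (∈-fixedPoints fx) (∈-fixedPoints fy)

    ≡⇒index≡ : ∀ {x y} (fx : Fixed x) (fy : Fixed y) → x ≡ y → index fx ≡ index fy
    ≡⇒index≡ fx fy x≡y = sym (index-lookup fy (index fx) (trans (lookup-index fx) x≡y))

  toCoordinates : Carrier → Fin |K| × Fin |K|
  toCoordinates x = index (im-fixed x) , index (re-fixed x)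

  coordinates : Carrier ↔ (Fin |K| × Fin |K|)
  coordinates = mk↔ₛ′ toCoordinates from to∘from from∘to
    where
    from : Fin |K| × Fin |K| → Carrier
    from (i , j) = lookup fixedPoints j + lookup fixedPoints i * ω
    to∘from : ∀ ij → toCoordinates (from ij) ≡ ij
    to∘from (i , j) = cong₂ _,_
      (index-lookup _ i (sym (im[a+bω]≡b _ _ (fixed-lookup j) (fixed-lookup i))))
      (index-lookup _ j (sym (re[a+bω]≡a _ _ (fixed-lookup j) (fixed-lookup i))))
    from∘to : ∀ x → from (toCoordinates x) ≡ x
    from∘to x = trans (cong₂ (λ a b → a + b * ω) (lookup-index (re-fixed x)) (lookup-index (im-fixed x))) (re+im*ω x)

  |K|≡Q : |K| ≡ Q
  |K|≡Q = m*m≡n*n⇒m≡n (trans (sym (↔⇒≡ |F|↔|K|*|K|)) |F|≡Q*Q)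
    where
    |F|↔|K|*|K| : Fin (q ℕ.^ (2 ℕ.* k)) ↔ Fin (|K| ℕ.* |K|)
    |F|↔|K|*|K| = ↔-trans (↔-sym (FiniteField.enumeration F)) (↔-trans coordinates (↔-sym Fin.*↔×))

  -- The norm z ↦ z^(Q+1) = z · conj z

  norm : Carrier → Carrier
  norm z = z ^ suc Q

  norm-fixed : ∀ z → Fixed (norm z)
  norm-fixed z = begin
    conj (z * conj z)               ≡⟨ conj-* z (conj z) ⟩
    conj z * conj (conj z)          ≡⟨ cong (conj z *_) (conj-involutive z) ⟩
    conj z * z                      ≡⟨ *-comm (conj z) z ⟩
    z * conj z                      ∎

  -- A fibre of the norm consists of roots of X^(Q+1) - c.
  length-normFibre≤1+Q : ∀ c zs → Unique zs → All (λ z → norm z ≡ c) zs → length zs ≤ suc Q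
  length-normFibre≤1+Q c zs zs! fibre = subst (length zs ≤_) (cong suc (length-replicate Q))
    (roots≤degree (- c ∷ replicate Q 0#) zs zs! (All.map (λ {z} → root z) fibre))
    where
    root : ∀ z → norm z ≡ c → evalMonic (- c ∷ replicate Q 0#) z ≡ 0#
    root z norm-z≡c = begin
      - c + z * evalMonic (replicate Q 0#) z    ≡⟨ cong (λ t → - c + z * t) (evalMonic-replicate-0 Q z) ⟩
      - c + norm z                              ≡⟨ +-comm (- c) (norm z) ⟩
      norm z - c                                ≡⟨ x≡y⇒x-y≡0 norm-z≡c ⟩
      0#                                        ∎

  -- Otherwise all Q² elements would lie in the fibres over the Q - 1 points
  -- of K ∖ {c}, each of size at most Q + 1.
  norm-surjective : ∀ {c} → Fixed c → c ≢ 0# → ∃ λ z → z ≢ 0# × c ≡ norm z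
  norm-surjective {c} fc c≢0 with Any.any? (λ z → norm z ≟ c) elements
  ... | yes hit = let (z , norm-z≡c) = Any.satisfied hit in
                  z , (λ z≡0 → c≢0 (trans (sym norm-z≡c) (trans (cong norm z≡0) (zeroˡ _)))) , sym norm-z≡c
  ... | no  miss = contradiction counted (ℕ.<⇒≱ (subst (length others ℕ.* suc Q <_)
                      (sym (trans length-elements |F|≡Q*Q))
                      (m<n⇒m*[1+n]<n*n (subst (length others <_) |K|≡Q others<|K|))))
    where
    c? : ∀ y → Dec (y ≡ c)
    c? y = y ≟ c
    others : List Carrier
    others = filter (∁? c?) fixedPoints
    others<|K| : length others < |K|
    others<|K| = filter-notAll (∁? c?) fixedPoints (lose (∈-fixedPoints fc) λ c≢c → c≢c refl)
    norm∈others : All (λ x → norm x ∈ others) elements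
    norm∈others = All.tabulate λ {x} x∈ →
      ∈ₚ.∈-filter⁺ (∁? c?) (∈-fixedPoints (norm-fixed x)) (λ norm-x≡c → miss (lose x∈ norm-x≡c))
    counted : length elements ≤ length others ℕ.* suc Q
    counted = length≤length*fibreBound _≟_ norm (suc Q) length-normFibre≤1+Q others elements elements-unique norm∈others

  private
    ^ᶠ≡norm : ∀ z → FiniteField._^_ F z (Q ℕ.+ 1) ≡ norm z
    ^ᶠ≡norm z = trans (^ᶠ≗^ z (Q ℕ.+ 1)) (cong (z ^_) (ℕ.+-comm Q 1))



  InS⇒im≡∧re≢ : ∀ x y → InS {q} {2 ℕ.* k} F k (y - x) → im x ≡ im y × re x ≢ re y
  InS⇒im≡∧re≢ x y (z , z≢0 , y-x≡zᵠ⁺¹) = sym (x-y≡0⇒x≡y im[y-x]≡0) , distinct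
    where
    y-x≡norm : y - x ≡ norm z
    y-x≡norm = trans y-x≡zᵠ⁺¹ (^ᶠ≡norm z)
    im[y-x]≡0 : im y - im x ≡ 0#
    im[y-x]≡0 = trans (sym (im-- y x)) (fixed⇒im≡0 (subst Fixed (sym y-x≡norm) (norm-fixed z)))
    distinct : re x ≢ re y
    distinct re-x≡re-y = ^-nonzero (suc Q) z≢0 (trans (sym y-x≡norm) (x≡y⇒x-y≡0 y≡x))
      where
      y≡x : y ≡ x
      y≡x = begin
        y                   ≡⟨ re+im*ω y ⟨
        re y + im y * ω     ≡⟨ cong₂ (λ a b → a + b * ω) (sym re-x≡re-y) (x-y≡0⇒x≡y im[y-x]≡0) ⟩
        re x + im x * ω     ≡⟨ re+im*ω x ⟩
        x                   ∎

  im≡∧re≢⇒InS : ∀ x y → im x ≡ im y → re x ≢ re y → InS {q} {2 ℕ.* k} F k (y - x)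
  im≡∧re≢⇒InS x y im-x≡im-y re-x≢re-y =
    let (z , z≢0 , y-x≡norm) = norm-surjective fixed nonzero in
    z , z≢0 , trans y-x≡norm (sym (^ᶠ≡norm z))
    where
    fixed : Fixed (y - x)
    fixed = im≡0⇒fixed (trans (im-- y x) (x≡y⇒x-y≡0 (sym im-x≡im-y)))
    nonzero : y - x ≢ 0#
    nonzero y-x≡0 = re-x≢re-y (cong re (sym (x-y≡0⇒x≡y y-x≡0)))

  AdjacentCoordinates : Carrier → Carrier → Set
  AdjacentCoordinates x y = proj₁ (toCoordinates x) ≡ proj₁ (toCoordinates y) × proj₂ (toCoordinates x) ≢ proj₂ (toCoordinates y)

  InS⇒adjacentCoordinates : ∀ x y → InS {q} {2 ℕ.* k} F k (y - x) → AdjacentCoordinates x y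
  InS⇒adjacentCoordinates x y s = ≡⇒index≡ (im-fixed x) (im-fixed y) (proj₁ (InS⇒im≡∧re≢ x y s))
         , λ eq → proj₂ (InS⇒im≡∧re≢ x y s) (index≡⇒≡ (re-fixed x) (re-fixed y) eq)

  adjacentCoordinates⇒InS : ∀ x y → AdjacentCoordinates x y → InS {q} {2 ℕ.* k} F k (y - x)
  adjacentCoordinates⇒InS x y p = im≡∧re≢⇒InS x y (index≡⇒≡ (im-fixed x) (im-fixed y) (proj₁ p))
                              (λ eq → proj₂ p (≡⇒index≡ (re-fixed x) (re-fixed y) eq))

  Γ≅copiesOfComplete : Γ {q} {2 ℕ.* k} F k ≅ copiesOfComplete Q Q
  Γ≅copiesOfComplete = subst (λ m → Γ {q} {2 ℕ.* k} F k ≅ copiesOfComplete m m) |K|≡Q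
    (coordinates , λ x y → mk⇔ (InS⇒adjacentCoordinates x y) (adjacentCoordinates⇒InS x y))

complement-copiesOfComplete : ∀ {G c m} → G ≅ copiesOfComplete c m → complement G ≅ completeMultipartite c m
complement-copiesOfComplete {G} (f , adj⇔) = f , λ x y → mk⇔ (to x y) (from x y)
  where
  module f = Inverse f
  to : ∀ x y → Adj (complement G) x y → proj₁ (f.to x) ≢ proj₁ (f.to y)
  to x y (x≢y , ¬adj) same-copy with proj₂ (f.to x) Fin.≟ proj₂ (f.to y)
  ... | yes same-index = x≢y (trans (sym (f.strictlyInverseʳ x))
                                (trans (cong f.from (cong₂ _,_ same-copy same-index)) (f.strictlyInverseʳ y)))
  ... | no  other-index = ¬adj (Equivalence.from (adj⇔ x y) (same-copy , other-index))
  from : ∀ x y → proj₁ (f.to x) ≢ proj₁ (f.to y) → Adj (complement G) x y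
  from x y other-copy = (λ { refl → other-copy refl }) , λ adj → other-copy (proj₁ (Equivalence.to (adj⇔ x y) adj))

open import Data.Nat using (_*_; _^_)

lemma4p1 : (q k : ℕ) → IsPrimePower q → k ≥ 1 →
    (F : FiniteField (q ^ (2 * k))) →
    (Γ {q} {2 * k} F k ≅ copiesOfComplete (q ^ k) (q ^ k))
    × (complement (Γ {q} {2 * k} F k) ≅ completeMultipartite (q ^ k) (q ^ k))
lemma4p1 q k q-prime-power k≥1 F = Γ≅copiesOfComplete , complement-copiesOfComplete Γ≅copiesOfComplete
  where open QuadraticExtension q-prime-power k≥1 F
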